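{- For all integers $\lambda\ge 0$ and $k,m\ge 1$ there exists $t$ with the following property. Let $G$ be a $\lambda$-spread digraph such that no vertex of $G$ is $(k,m)$-rich. Then $V(G)$ can be partitioned into $t$ sets $X_1,\ldots,X_t$ such that for $1\le i\le t$, either no $(m+1)$-clique of $G[X_i]$ has a source or no $(m+1)$-clique of $G[X_i]$ has a sink.
   Context: Digraphs are finite orientations of simple graphs (no loops, parallel or antiparallel edges); $G^*$ is the underlying graph. $N^+(v)$ and $N^-(v)$ are the sets of out-neighbours and in-neighbours of $v$. A clique of $G$ is a set of pairwise $G^*$-adjacent vertices; an $m$-clique is a clique of cardinality $m$. A vertex of a clique $X$ is a source of $X$ if it is adjacent to every other vertex of $X$ (edges directed away from it), and a sink if every other vertex of $X$ is adjacent to it. $G$ is $\lambda$-spread if for every vertex $v$ and all $A\subseteq N^+(v)$, $B\subseteq N^-(v)$ with $|A|=|B|=\lambda$, some vertex of $A$ is $G^*$-adjacent with some vertex of $B$. For sets $A,B$, $A$ is $G^*$-complete with $B$ if $A\cap B=\emptyset$ and every vertex of $A$ is $G^*$-adjacent with every vertex of $B$. A vertex $v$ is $(k,m)$-rich if there exist $k$ pairwise disjoint $m$-cliques $A_1,\ldots,A_k\subseteq N^+(v)$ and $k$ pairwise disjoint $m$-cliques $B_1,\ldots,B_k\subseteq N^-(v)$ such that $A_1\cup\cdots\cup A_k$ is $G^*$-complete with $B_1\cup\cdots\cup B_k$. -}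

module Defs where

open import Data.Nat using (ℕ; suc)
open import Data.Fin using (Fin)
open import Data.Fin.Subset using (Subset; _∈_; _⊆_; ∣_∣)
open import Data.Product using (Σ; ∃; _×_; _,_)
open import Data.Sum using (_⊎_)
open import Relation.Nullary using (¬_; Dec)
open import Relation.Binary.PropositionalEquality using (_≡_; _≢_)

-- A digraph on the vertex set Fin n: an orientation of a simple graph.
record Digraph (n : ℕ) : Set₁ where
  field
    Edge     : Fin n → Fin n → Set
    edge?    : (u v : Fin n) → Dec (Edge u v)
    irrefl   : (v : Fin n) → ¬ Edge v v
    asym     : (u v : Fin n) → Edge u v → ¬ Edge v u

open Digraph public

module _ {n : ℕ} (G : Digraph n) where

  Adj : Fin n → Fin n → Set
  Adj u v = Edge G u v ⊎ Edge G v u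

  ⊆Out : Fin n → Subset n → Set
  ⊆Out v A = ∀ a → a ∈ A → Edge G v a

  ⊆In : Fin n → Subset n → Set
  ⊆In v B = ∀ b → b ∈ B → Edge G b v

  IsClique : Subset n → Set
  IsClique X = ∀ x y → x ∈ X → y ∈ X → x ≢ y → Adj x y

  IsSource : Subset n → Fin n → Set
  IsSource X s = s ∈ X × (∀ y → y ∈ X → y ≢ s → Edge G s y)

  IsSink : Subset n → Fin n → Set
  IsSink X s = s ∈ X × (∀ y → y ∈ X → y ≢ s → Edge G y s)

  Spread : ℕ → Set
  Spread λ' = ∀ v (A B : Subset n) → ⊆Out v A → ⊆In v B →
              ∣ A ∣ ≡ λ' → ∣ B ∣ ≡ λ' →
              Σ (Fin n) λ a → Σ (Fin n) λ b → a ∈ A × b ∈ B × Adj a b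

  DisjointCliques : (k m : ℕ) → (Fin k → Subset n) → Set
  DisjointCliques k m A =
    (∀ i → IsClique (A i) × ∣ A i ∣ ≡ m) ×
    (∀ i j → i ≢ j → ∀ x → x ∈ A i → ¬ (x ∈ A j))

  Rich : (k m : ℕ) → Fin n → Set
  Rich k m v =
    Σ (Fin k → Subset n) λ A → Σ (Fin k → Subset n) λ B →
      DisjointCliques k m A × DisjointCliques k m B ×
      (∀ i → ⊆Out v (A i)) × (∀ i → ⊆In v (B i)) ×
      (∀ i j a b → a ∈ A i → b ∈ B j → a ≢ b × Adj a b)

  Part : {t : ℕ} → (Fin n → Fin t) → Fin t → Fin n → Set
  Part f i v = f v ≡ i

  InPart : {t : ℕ} → (Fin n → Fin t) → Fin t → Subset n → Set
  InPart f i X = ∀ x → x ∈ X → Part f i x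

  NoSourcedClique : {t : ℕ} → (Fin n → Fin t) → Fin t → ℕ → Set
  NoSourcedClique f i m = ∀ X → InPart f i X → IsClique X → ∣ X ∣ ≡ suc m →
                          ∀ s → ¬ IsSource X s

  NoSinkedClique : {t : ℕ} → (Fin n → Fin t) → Fin t → ℕ → Set
  NoSinkedClique f i m = ∀ X → InPart f i X → IsClique X → ∣ X ∣ ≡ suc m →
                         ∀ s → ¬ IsSink X s

module Submission where

-- For a vertex v, greedily collect pairwise disjoint m-cliques inside N⁺(v), and inside N⁻(v).
-- If both collections reach a fixed size K, colour each pair (A, B) of an out-clique and an
-- in-clique either "complete" or by the positions (p, q) of a non-adjacent pair; bipartite
-- Ramsey yields k + λ of each with a common colour. "Complete" makes v (k,m)-rich, while a
-- common (p, q) picks λ out-neighbours and λ in-neighbours of v with no edge between them,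
-- against λ-spreadness. So on one side of v the greedy stops early, and the at most K·m
-- vertices T(v) of the collected cliques meet every m-clique on that side. For each j, the map
-- sending v to the j-th vertex of T(v) is properly 4-coloured by the parities of its descending
-- runs along the two orders of Fin n; a part records the side and all these colours. If s is a source (say) of an (m+1)-clique X inside a part of the
-- out-side, then X - s is an m-clique in N⁺(s), so it contains a vertex of T(s), whose colour
-- differs from that of s.

open import Defs

open import Data.Bool using (Bool; false; not)
open import Data.Bool.Properties using (not-¬)
open import Data.Empty using (⊥; ⊥-elim)
open import Data.Fin
  using (Fin; zero; suc; toℕ; fromℕ<; inject≤; cast; combine; remQuot; funToFin; finToFun)
open import Data.Fin.Properties
  using ( _≟_; all?; ¬∀⟶∃¬; 2↔Bool; toℕ-injective; toℕ≤n; toℕ-fromℕ<; inject≤-injective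
        ; cast-involutive; combine-injective; remQuot-combine; finToFun-funToFin )
open import Data.Fin.Subset
  using (Subset; inside; outside; ⁅_⁆; _∪_; _∩_; ⋃; _-_; ∣_∣; Nonempty; Empty)
  renaming (_∈_ to _∈ₛ_; _∉_ to _∉ₛ_)
open import Data.Fin.Subset.Properties
  using ( _∈?_; nonempty?; anySubset?; ∉⊥; ∣⊥∣≡0; p─⊥≡p; p─q⊆p; ∪-identityˡ
        ; x∈p∪q⁻; x∈p∩q⁺; x∈p∩q⁻; x∈⁅y⁆⇒x≡y )
open import Data.List using (List; []; _∷_; length; map; concatMap; lookup; filter; take; allFin)
open import Data.List.Properties using (length-++; length-map; length-take; length-tabulate)
open import Data.List.Membership.Propositional using (_∈_; find)
open import Data.List.Membership.Propositional.Properties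
  using (∈-allFin; ∈-map⁺; ∈-map⁻; ∈-lookup; ∈-concatMap⁺)
open import Data.List.Relation.Binary.Sublist.Propositional
  using (_⊆_; []; _∷_; _∷ʳ_; ⊆-refl; ⊆-trans)
open import Data.List.Relation.Binary.Sublist.Propositional.Properties
  using (All-resp-⊆; filter-⊆; take-⊆)
open import Data.List.Relation.Unary.All as All using (All; []; _∷_)
open import Data.List.Relation.Unary.All.Properties
  using (all-filter; filter⁺; ¬Any⇒All¬) renaming (map⁺ to All-map⁺)
open import Data.List.Relation.Unary.AllPairs as AllPairs using (AllPairs; []; _∷_)
open import Data.List.Relation.Unary.AllPairs.Properties using () renaming (map⁺ to AllPairs-map⁺)
open import Data.List.Relation.Unary.Any as Any using (Any; here; there)
open import Data.List.Relation.Unary.Any.Properties using (lookup-index)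
open import Data.List.Relation.Unary.Unique.Propositional using (Unique)
open import Data.Nat using (ℕ; zero; suc; _+_; _*_; _^_; _∸_; _≤_; _<_; _≥_; s≤s; z≤n)
  renaming (_≟_ to _≟ℕ_)
open import Data.Nat.Properties
  using ( _<?_; suc-injective; ≤-refl; ≤-trans; <⇒≤; <-≤-trans; ≮⇒≥; <-cmp; n<1+n; m≤m+n; m≤n+m
        ; +-identityʳ; +-suc; *-assoc; +-cancelˡ-≤; +-monoˡ-≤; *-monoˡ-≤; ∸-monoʳ-<; m≤n⇒m⊓n≡m
        ; module ≤-Reasoning )
open import Data.Product using (Σ; ∃; ∃₂; _×_; _,_; proj₁; proj₂; swap)
open import Data.Sum using (_⊎_; inj₁; inj₂; [_,_]′; map₂)
open import Data.Vec using ([]; _∷_; here; there)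
open import Function using (id; _∘_; _on_)
open import Function.Bundles using (Injection)
open import Function.Properties.Inverse using (↔-sym; ↔⇒↣)
open import Level using (0ℓ)
open import Relation.Binary using (DecidableEquality)
open import Relation.Binary.Definitions using (Symmetric; tri<; tri≈; tri>)
open import Relation.Binary.PropositionalEquality
  using (_≡_; _≢_; refl; sym; trans; cong; cong₂; subst; module ≡-Reasoning)
open import Relation.Nullary using (¬_; Dec; yes; no; ¬?; contradiction)
open import Relation.Nullary.Decidable using (map′; _×-dec_; _⊎-dec_; _→-dec_; decidable-stable)
open import Relation.Unary using (Pred; Decidable)

private variable
  A B C : Set
  n : ℕ

AllPairs-resp-⊆ : {R : A → A → Set} {xs ys : List A} → xs ⊆ ys → AllPairs R ys → AllPairs R xs
AllPairs-resp-⊆ []         []       = []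
AllPairs-resp-⊆ (_ ∷ʳ τ)   (_ ∷ ps) = AllPairs-resp-⊆ τ ps
AllPairs-resp-⊆ (refl ∷ τ) (p ∷ ps) = All-resp-⊆ τ p ∷ AllPairs-resp-⊆ τ ps

AllPairs-lookup : {R : A → A → Set} {xs : List A} → Symmetric R → AllPairs R xs →
                  ∀ {i j} → i ≢ j → R (lookup xs i) (lookup xs j)
AllPairs-lookup R-sym (r ∷ rs) {zero}  {zero}  i≢j = contradiction refl i≢j
AllPairs-lookup R-sym (r ∷ rs) {zero}  {suc j} _   = All.lookup r (∈-lookup j)
AllPairs-lookup R-sym (r ∷ rs) {suc i} {zero}  _   = R-sym (All.lookup r (∈-lookup i))
AllPairs-lookup R-sym (r ∷ rs) {suc i} {suc j} i≢j = AllPairs-lookup R-sym rs (i≢j ∘ cong suc)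

sublistOfLength : ∀ n (xs : List A) → n ≤ length xs → ∃ λ ys → ys ⊆ xs × length ys ≡ n
sublistOfLength n xs n≤ = take n xs , take-⊆ n xs , trans (length-take n xs) (m≤n⇒m⊓n≡m n≤)

length-filter+length-filter-¬ : {P : Pred A 0ℓ} (P? : Decidable P) → ∀ xs →
                                length (filter P? xs) + length (filter (¬? ∘ P?) xs) ≡ length xs
length-filter+length-filter-¬ P? []       = refl
length-filter+length-filter-¬ P? (x ∷ xs) with P? x
... | yes _ = cong suc (length-filter+length-filter-¬ P? xs)
... | no _  = trans (+-suc _ _) (cong suc (length-filter+length-filter-¬ P? xs))

lookupOr : A → List A → ℕ → A
lookupOr d []       _       = d
lookupOr d (x ∷ xs) zero    = x
lookupOr d (x ∷ xs) (suc i) = lookupOr d xs i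

∈⇒lookupOr : ∀ d {x} {xs : List A} → x ∈ xs → ∃ λ i → i < length xs × lookupOr d xs i ≡ x
∈⇒lookupOr d (here refl) = 0 , s≤s z≤n , refl
∈⇒lookupOr d (there x∈) with ∈⇒lookupOr d x∈
... | i , i< , eq = suc i , s≤s i< , eq

-- Pigeonhole principle and bipartite Ramsey theorem

m+n<o+p⇒o≤m⇒n<p : ∀ {m n o p} → m + n < o + p → o ≤ m → n < p
m+n<o+p⇒o≤m⇒n<p {m} {n} {o} {p} m+n<o+p o≤m = +-cancelˡ-≤ m (suc n) p (begin
  m + suc n  ≡⟨ +-suc m n ⟩
  suc m + n  ≤⟨ m+n<o+p ⟩
  o + p      ≤⟨ +-monoˡ-≤ p o≤m ⟩
  m + p      ∎)
  where open ≤-Reasoning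

module _ (_≟_ : DecidableEquality C) (colour : A → C) where

  pigeonhole : ∀ (cs : List C) M xs → All (λ x → colour x ∈ cs) xs → length cs * M < length xs →
               ∃₂ λ κ ys → ys ⊆ xs × All (λ x → colour x ≡ κ) ys × M < length ys
  pigeonhole [] M (x ∷ xs) (() ∷ _) _
  pigeonhole (c ∷ cs) M xs coloured big with M <? length (filter (λ x → colour x ≟ c) xs)
  ... | yes bigClass = c , _ , filter-⊆ _ xs , all-filter _ xs , bigClass
  ... | no smallClass
    with pigeonhole cs M (filter (¬? ∘ (λ x → colour x ≟ c)) xs)
           (All.zipWith (λ (∈c∷cs , ≢c) → Any.tail ≢c ∈c∷cs) (filter⁺ _ coloured , all-filter _ xs))
           (m+n<o+p⇒o≤m⇒n<p
             (subst (_ <_) (sym (length-filter+length-filter-¬ (λ x → colour x ≟ c) xs)) big)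
             (≮⇒≥ smallClass))
  ... | κ , ys , ys⊆ , mono , bigClass = κ , ys , ⊆-trans ys⊆ (filter-⊆ _ xs) , mono , bigClass

pigeonholeFin : ∀ {c} (colour : A → Fin c) M xs → c * M < length xs →
                ∃₂ λ κ ys → ys ⊆ xs × All (λ x → colour x ≡ κ) ys × M < length ys
pigeonholeFin {c = c} colour M xs big =
  pigeonhole _≟_ colour (allFin c) M xs (All.tabulate λ _ → ∈-allFin _)
    (subst (λ l → l * M < length xs) (sym (length-tabulate {n = c} id)) big)

module _ {c : ℕ} (colour : A → B → Fin c) where

  RowConstant : List B → A → Set
  RowConstant bs a = ∃ λ κ → All (λ b → colour a b ≡ κ) bs

  homogeniseRows : ∀ (as : List A) M bs → c ^ length as * M < length bs →
                   ∃ λ bs′ → bs′ ⊆ bs × M < length bs′ × All (RowConstant bs′) as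
  homogeniseRows [] M bs big = bs , ⊆-refl , subst (_< length bs) (+-identityʳ M) big , []
  homogeniseRows (a ∷ as) M bs big
    with pigeonholeFin (colour a) (c ^ length as * M) bs (subst (_< length bs) (*-assoc c _ M) big)
  ... | κ , bs₁ , bs₁⊆ , mono , big₁ with homogeniseRows as M bs₁ big₁
  ... | bs′ , bs′⊆ , big′ , constant =
    bs′ , ⊆-trans bs′⊆ bs₁⊆ , big′ , (κ , All-resp-⊆ bs′⊆ mono) ∷ constant

  bipartiteRamsey : ∀ r (as : List A) (bs : List B) → c * r < length as → c ^ suc (c * r) * r < length bs →
                    ∃₂ λ as′ bs′ → as′ ⊆ as × bs′ ⊆ bs × r < length as′ × r < length bs′ ×
                      ∃ λ κ → All (λ a → All (λ b → colour a b ≡ κ) bs′) as′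
  bipartiteRamsey r as bs enoughRows enoughColumns with sublistOfLength _ as enoughRows
  ... | rows , rows⊆ , |rows|
    with homogeniseRows rows r bs (subst (λ l → c ^ l * r < length bs) (sym |rows|) enoughColumns)
  ... | [] , _ , () , _
  ... | b₀ ∷ bs′ , bs′⊆ , big , constant
    with pigeonholeFin (λ a → colour a b₀) r rows (subst (c * r <_) (sym |rows|) ≤-refl)
  ... | κ , as′ , as′⊆ , mono , big′ =
    as′ , b₀ ∷ bs′ , ⊆-trans as′⊆ rows⊆ , bs′⊆ , big′ , big ,
    κ , All.zipWith constantκ (All-resp-⊆ as′⊆ constant , mono)
    where
    constantκ : ∀ {a} → RowConstant (b₀ ∷ bs′) a × colour a b₀ ≡ κ → All (λ b → colour a b ≡ κ) (b₀ ∷ bs′)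
    constantκ ((_ , at₀ ∷ rest) , at₀≡κ) = All.map (λ e → trans e (trans (sym at₀) at₀≡κ)) (at₀ ∷ rest)

x∉p-x : ∀ (p : Subset n) x → x ∉ₛ p - x
x∉p-x (_ ∷ p) (suc x) (there x∈) = x∉p-x p x x∈

x∈p⇒suc∣p-x∣≡∣p∣ : ∀ {p : Subset n} {x} → x ∈ₛ p → suc ∣ p - x ∣ ≡ ∣ p ∣
x∈p⇒suc∣p-x∣≡∣p∣ {p = inside ∷ p}  here       = cong (suc ∘ ∣_∣) (p─⊥≡p p)
x∈p⇒suc∣p-x∣≡∣p∣ {p = inside ∷ p}  (there x∈) = cong suc (x∈p⇒suc∣p-x∣≡∣p∣ x∈)
x∈p⇒suc∣p-x∣≡∣p∣ {p = outside ∷ p} (there x∈) = x∈p⇒suc∣p-x∣≡∣p∣ x∈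

x∉p⇒∣⁅x⁆∪p∣≡suc∣p∣ : ∀ {p : Subset n} x → x ∉ₛ p → ∣ ⁅ x ⁆ ∪ p ∣ ≡ suc ∣ p ∣
x∉p⇒∣⁅x⁆∪p∣≡suc∣p∣ {p = inside ∷ p}  zero    x∉ = contradiction here x∉
x∉p⇒∣⁅x⁆∪p∣≡suc∣p∣ {p = outside ∷ p} zero    x∉ = cong (suc ∘ ∣_∣) (∪-identityˡ p)
x∉p⇒∣⁅x⁆∪p∣≡suc∣p∣ {p = inside ∷ p}  (suc x) x∉ = cong suc (x∉p⇒∣⁅x⁆∪p∣≡suc∣p∣ x (x∉ ∘ there))
x∉p⇒∣⁅x⁆∪p∣≡suc∣p∣ {p = outside ∷ p} (suc x) x∉ = x∉p⇒∣⁅x⁆∪p∣≡suc∣p∣ x (x∉ ∘ there)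

∈-⋃⁅⁆⁻ : ∀ (xs : List (Fin n)) {y} → y ∈ₛ ⋃ (map ⁅_⁆ xs) → y ∈ xs
∈-⋃⁅⁆⁻ []       y∈ = contradiction y∈ ∉⊥
∈-⋃⁅⁆⁻ (x ∷ xs) y∈ with x∈p∪q⁻ ⁅ x ⁆ (⋃ (map ⁅_⁆ xs)) y∈
... | inj₁ y∈⁅x⁆ = here (x∈⁅y⁆⇒x≡y x y∈⁅x⁆)
... | inj₂ y∈⋃   = there (∈-⋃⁅⁆⁻ xs y∈⋃)

∣⋃⁅⁆∣≡length : ∀ {xs : List (Fin n)} → Unique xs → ∣ ⋃ (map ⁅_⁆ xs) ∣ ≡ length xs
∣⋃⁅⁆∣≡length {n} {[]}     []            = ∣⊥∣≡0 n
∣⋃⁅⁆∣≡length {_} {x ∷ xs} (x∉xs ∷ uniq) =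
  trans (x∉p⇒∣⁅x⁆∪p∣≡suc∣p∣ x (λ x∈ → All.lookup x∉xs (∈-⋃⁅⁆⁻ xs x∈) refl))
        (cong suc (∣⋃⁅⁆∣≡length uniq))

members : Subset n → List (Fin n)
members []            = []
members (inside ∷ p)  = zero ∷ map suc (members p)
members (outside ∷ p) = map suc (members p)

length-members : ∀ (p : Subset n) → length (members p) ≡ ∣ p ∣
length-members []            = refl
length-members (inside ∷ p)  = cong suc (trans (length-map suc (members p)) (length-members p))
length-members (outside ∷ p) = trans (length-map suc (members p)) (length-members p)

∈-members⁺ : ∀ {p : Subset n} {x} → x ∈ₛ p → x ∈ members p
∈-members⁺ {p = inside ∷ p}  here       = here refl
∈-members⁺ {p = inside ∷ p}  (there x∈) = there (∈-map⁺ suc (∈-members⁺ x∈))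
∈-members⁺ {p = outside ∷ p} (there x∈) = ∈-map⁺ suc (∈-members⁺ x∈)

∈-members⁻ : ∀ (p : Subset n) {x} → x ∈ members p → x ∈ₛ p
∈-members⁻ (inside ∷ p) (here refl) = here
∈-members⁻ (inside ∷ p) (there x∈) with ∈-map⁻ suc x∈
... | _ , y∈ , refl = there (∈-members⁻ p y∈)
∈-members⁻ (outside ∷ p) x∈ with ∈-map⁻ suc x∈
... | _ , y∈ , refl = there (∈-members⁻ p y∈)

length-concatMap-members : ∀ {m} {Zs : List (Subset n)} → All (λ Z → ∣ Z ∣ ≡ m) Zs →
                           length (concatMap members Zs) ≡ length Zs * m
length-concatMap-members                []           = refl
length-concatMap-members {Zs = Z ∷ _} (|Z| ∷ |Zs|) =
  trans (length-++ (members Z))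
        (cong₂ _+_ (trans (length-members Z) |Z|) (length-concatMap-members |Zs|))

module _ (X : Subset n) {m} (|X| : ∣ X ∣ ≡ m) where

  private
    |members| : length (members X) ≡ m
    |members| = trans (length-members X) |X|

  element : Fin m → Fin n
  element p = lookup (members X) (cast (sym |members|) p)

  element-∈ : ∀ p → element p ∈ₛ X
  element-∈ p = ∈-members⁻ X (∈-lookup (cast (sym |members|) p))

  element-surjective : ∀ {x} → x ∈ₛ X → ∃ λ p → element p ≡ x
  element-surjective {x} x∈ = cast |members| i , (begin
    lookup (members X) (cast (sym |members|) (cast |members| i))
      ≡⟨ cong (lookup (members X)) (cast-involutive (sym |members|) |members| i) ⟩
    lookup (members X) i
      ≡⟨ sym (lookup-index (∈-members⁺ x∈)) ⟩
    x ∎)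
    where
    open ≡-Reasoning
    i : Fin (length (members X))
    i = Any.index (∈-members⁺ x∈)

Disjoint : Subset n → Subset n → Set
Disjoint Y Z = Empty (Y ∩ Z)

Disjoint-sym : Symmetric (Disjoint {n})
Disjoint-sym YZ-disjoint (x , x∈Z∩Y) = YZ-disjoint (x , x∈p∩q⁺ (swap (x∈p∩q⁻ _ _ x∈Z∩Y)))

module _ {P : Pred (Subset n) 0ℓ} (P? : Decidable P) where

  Packing : ℕ → Set
  Packing K = ∃ λ (Ys : List (∃ P)) → length Ys ≡ K × AllPairs (Disjoint on proj₁) Ys

  Cover : ℕ → Set
  Cover K = ∃ λ (Zs : List (∃ P)) → length Zs ≤ K × ∀ Y → P Y → Any (λ Z → Nonempty (Y ∩ proj₁ Z)) Zs

  private
    extendPacking : ∀ fuel (Zs : List (∃ P)) → AllPairs (Disjoint on proj₁) Zs →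
                    Packing (fuel + length Zs) ⊎ Cover (fuel + length Zs)
    extendPacking zero       Zs disjoint = inj₁ (Zs , refl , disjoint)
    extendPacking (suc fuel) Zs disjoint
      with anySubset? (λ Y → P? Y ×-dec ¬? (Any.any? (λ Z → nonempty? (Y ∩ proj₁ Z)) Zs))
    ... | yes (Y , pY , avoids) = subst (λ K → Packing K ⊎ Cover K) (+-suc fuel (length Zs))
            (extendPacking fuel ((Y , pY) ∷ Zs) (¬Any⇒All¬ Zs avoids ∷ disjoint))
    ... | no maximal = inj₂ (Zs , m≤n+m _ (suc fuel) , λ Y pY →
            decidable-stable (Any.any? (λ Z → nonempty? (Y ∩ proj₁ Z)) Zs)
                             λ avoids → maximal (Y , pY , avoids))

  packingOrCover : ∀ K → Packing K ⊎ Cover K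
  packingOrCover K = subst (λ K → Packing K ⊎ Cover K) (+-identityʳ K) (extendPacking K [] [])

-- Proper colourings of functional graphs

module _ (r : A → ℕ) (h : A → A) where

  private
    -- The parity of the number of r-decreasing h-steps from v, following at most f of them;
    -- f = suc (r v) steps always suffice.
    parity : ℕ → A → Bool
    parity zero    v = false
    parity (suc f) v with r (h v) <? r v
    ... | yes _ = not (parity f (h v))
    ... | no _  = false

    parity-stable : ∀ f f′ v → r v < f → r v < f′ → parity f v ≡ parity f′ v
    parity-stable (suc f) (suc f′) v (s≤s v≤f) (s≤s v≤f′) with r (h v) <? r v
    ... | yes hv<v = cong not (parity-stable f f′ (h v) (<-≤-trans hv<v v≤f) (<-≤-trans hv<v v≤f′))
    ... | no _     = refl

  descentColouring : Σ (A → Bool) λ c → ∀ v → r (h v) < r v → c (h v) ≢ c v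
  descentColouring = (λ v → parity (suc (r v)) v) , proper
    where
    proper : ∀ v → r (h v) < r v → parity (suc (r (h v))) (h v) ≢ parity (suc (r v)) v
    proper v hv<v with r (h v) <? r v
    ... | yes _   = not-¬ (parity-stable _ _ (h v) (n<1+n _) hv<v)
    ... | no hv≮v = contradiction hv<v hv≮v

functionalColouring : (h : Fin n → Fin n) → Σ (Fin n → Fin 4) λ c → ∀ v → h v ≢ v → c (h v) ≢ c v
functionalColouring {n} h = colour , proper
  where
  open Injection (↔⇒↣ (↔-sym 2↔Bool)) using (to; injective)

  down : Σ (Fin n → Bool) λ c → ∀ v → toℕ (h v) < toℕ v → c (h v) ≢ c v
  down = descentColouring toℕ h

  up : Σ (Fin n → Bool) λ c → ∀ v → n ∸ toℕ (h v) < n ∸ toℕ v → c (h v) ≢ c v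
  up = descentColouring (λ u → n ∸ toℕ u) h

  colour : Fin n → Fin 4
  colour v = combine (to (proj₁ down v)) (to (proj₁ up v))

  proper : ∀ v → h v ≢ v → colour (h v) ≢ colour v
  proper v hv≢v same with combine-injective _ _ _ _ same | <-cmp (toℕ (h v)) (toℕ v)
  ... | sameDown , _ | tri< hv<v _ _ = proj₂ down v hv<v (injective sameDown)
  ... | _            | tri≈ _ hv≡v _ = hv≢v (toℕ-injective hv≡v)
  ... | _ , sameUp   | tri> _ _ v<hv = proj₂ up v (∸-monoʳ-< v<hv (toℕ≤n (h v))) (injective sameUp)

conflictColouring : ∀ D (H : Fin n → List (Fin n)) → (∀ v → length (H v) ≤ D) →
                    Σ (Fin n → Fin (4 ^ D)) λ c → ∀ v {x} → x ∈ H v → x ≢ v → c x ≢ c v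
conflictColouring {n} D H short = colour , proper
  where
  -- The j-th element of H v, or v itself when H v is shorter; such loops constrain nothing.
  hop : Fin D → Fin n → Fin n
  hop j v = lookupOr v (H v) (toℕ j)

  hopColour : Fin D → Fin n → Fin 4
  hopColour j = proj₁ (functionalColouring (hop j))

  colour : Fin n → Fin (4 ^ D)
  colour v = funToFin λ j → hopColour j v

  proper : ∀ v {x} → x ∈ H v → x ≢ v → colour x ≢ colour v
  proper v {x} x∈ x≢v same with ∈⇒lookupOr v x∈
  ... | i , i< , x≡ = proj₂ (functionalColouring (hop j)) v (subst (_≢ v) x≡hop x≢v)
                        (subst (λ y → hopColour j y ≡ hopColour j v) x≡hop sameAtj)
    where
    j : Fin D
    j = fromℕ< (<-≤-trans i< (short v))
    x≡hop : x ≡ hop j v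
    x≡hop = trans (sym x≡) (cong (lookupOr v (H v)) (sym (toℕ-fromℕ< _)))
    sameAtj : hopColour j x ≡ hopColour j v
    sameAtj = trans (sym (finToFun-funToFin (λ k → hopColour k x) j))
                (trans (cong (λ k → finToFun k j) same) (finToFun-funToFin (λ k → hopColour k v) j))

-- Partition from one-sided transversals

module _ (G : Digraph n) where

  adj? : ∀ x y → Dec (Adj G x y)
  adj? x y = edge? G x y ⊎-dec edge? G y x

  Adj-irrefl : ∀ x → ¬ Adj G x x
  Adj-irrefl x (inj₁ xx) = irrefl G x xx
  Adj-irrefl x (inj₂ xx) = irrefl G x xx

  Oriented : Fin 2 → Fin n → Fin n → Set
  Oriented zero       v u = Edge G v u
  Oriented (suc zero) v u = Edge G u v

  oriented? : ∀ σ v u → Dec (Oriented σ v u)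
  oriented? zero       v u = edge? G v u
  oriented? (suc zero) v u = edge? G u v

  Oriented-irrefl : ∀ σ {v u} → Oriented σ v u → u ≢ v
  Oriented-irrefl zero       vu refl = irrefl G _ vu
  Oriented-irrefl (suc zero) uv refl = irrefl G _ uv

  Within : (Fin n → Set) → Subset n → Set
  Within N Y = ∀ y → y ∈ₛ Y → N y

  record CliqueIn (m : ℕ) (N : Fin n → Set) (Y : Subset n) : Set where
    constructor mkCliqueIn
    field
      clique : IsClique G Y
      size   : ∣ Y ∣ ≡ m
      within : Within N Y

  open CliqueIn public

  cliqueIn? : ∀ m {N : Fin n → Set} → Decidable N → Decidable (CliqueIn m N)
  cliqueIn? m N? Y = map′ (λ (c , s , w) → mkCliqueIn c s w) (λ Y → clique Y , size Y , within Y)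
    (isClique? ×-dec ∣ Y ∣ ≟ℕ m ×-dec all? (λ y → y ∈? Y →-dec N? y))
    where
    isClique? : Dec (IsClique G Y)
    isClique? = all? λ x → all? λ y → x ∈? Y →-dec y ∈? Y →-dec ¬? (x ≟ y) →-dec adj? x y

  Transversal : ℕ → ℕ → (Fin n → Set) → Set
  Transversal m D N = ∃ λ (T : List (Fin n)) → length T ≤ D × ∀ Y → CliqueIn m N Y → ∃ λ x → x ∈ₛ Y × x ∈ T

  NoApexedClique : ∀ {t} → (Fin n → Fin n → Set) → (Fin n → Fin t) → Fin t → ℕ → Set
  NoApexedClique R f i m = ∀ X → InPart G f i X → IsClique G X → ∣ X ∣ ≡ suc m →
                           ∀ s → ¬ (s ∈ₛ X × (∀ y → y ∈ₛ X → y ≢ s → R s y))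

  apexDeleted : ∀ {m} (R : Fin n → Fin n → Set) X s → IsClique G X → ∣ X ∣ ≡ suc m → s ∈ₛ X →
                (∀ y → y ∈ₛ X → y ≢ s → R s y) → CliqueIn m (R s) (X - s)
  apexDeleted R X s X-clique |X| s∈X apex =
    mkCliqueIn (λ x y x∈ y∈ → X-clique x y (⊆X x∈) (⊆X y∈))
               (suc-injective (trans (x∈p⇒suc∣p-x∣≡∣p∣ s∈X) |X|))
               (λ y y∈ → apex y (⊆X y∈) λ { refl → x∉p-x X s y∈ })
    where
    ⊆X : ∀ {y} → y ∈ₛ X - s → y ∈ₛ X
    ⊆X = p─q⊆p X ⁅ s ⁆

  noApexedClique : ∀ {t} m (R : Fin n → Fin n → Set) (f : Fin n → Fin t) i →
                   (∀ s → f s ≡ i → ∀ Y → CliqueIn m (R s) Y → ∃ λ x → x ∈ₛ Y × f x ≢ f s) →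
                   NoApexedClique R f i m
  noApexedClique m R f i separated X X⊆i X-clique |X| s (s∈X , apex)
    with separated s (X⊆i s s∈X) (X - s) (apexDeleted R X s X-clique |X| s∈X apex)
  ... | x , x∈ , fx≢fs = fx≢fs (trans (X⊆i x (p─q⊆p X ⁅ s ⁆ x∈)) (sym (X⊆i s s∈X)))

  sourceOrSinkFree : ∀ {t} σ (f : Fin n → Fin t) i m → NoApexedClique (Oriented σ) f i m →
                     NoSourcedClique G f i m ⊎ NoSinkedClique G f i m
  sourceOrSinkFree zero       _ _ _ = inj₁
  sourceOrSinkFree (suc zero) _ _ _ = inj₂

  oneSidedPartition : ∀ m D → (∀ v → ∃ λ σ → Transversal m D (Oriented σ v)) →
                      Σ (Fin n → Fin (2 * 4 ^ D)) λ f →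
                        ∀ i → NoSourcedClique G f i m ⊎ NoSinkedClique G f i m
  oneSidedPartition m D transversal = key , λ i →
    sourceOrSinkFree (sideOf i) key i m (noApexedClique m _ key i (separated i))
    where
    side : Fin n → Fin 2
    side v = proj₁ (transversal v)

    T : Fin n → List (Fin n)
    T v = proj₁ (proj₂ (transversal v))

    colouring : Σ (Fin n → Fin (4 ^ D)) λ c → ∀ v {x} → x ∈ T v → x ≢ v → c x ≢ c v
    colouring = conflictColouring D T (proj₁ ∘ proj₂ ∘ proj₂ ∘ transversal)

    key : Fin n → Fin (2 * 4 ^ D)
    key v = combine (side v) (proj₁ colouring v)

    sideOf : Fin (2 * 4 ^ D) → Fin 2
    sideOf i = proj₁ (remQuot (4 ^ D) i)

    separated : ∀ i s → key s ≡ i → ∀ Y → CliqueIn m (Oriented (sideOf i) s) Y →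
                ∃ λ x → x ∈ₛ Y × key x ≢ key s
    separated _ s refl Y Y-clique rewrite cong proj₁ (remQuot-combine (side s) (proj₁ colouring s))
      with proj₂ (proj₂ (proj₂ (transversal s))) Y Y-clique
    ... | x , x∈Y , x∈T = x , x∈Y , λ same →
      proj₂ colouring s x∈T (Oriented-irrefl (side s) (within Y-clique x x∈Y))
                            (proj₂ (combine-injective (side x) _ (side s) _ same))

  -- Vertices without one-sided transversal

  coverToTransversal : ∀ m {N} (N? : Decidable N) {K} → Cover (cliqueIn? m N?) K → Transversal m (K * m) N
  coverToTransversal m {N} N? {K} (Zs , |Zs|≤K , covers) = concatMap members (map proj₁ Zs) , short , hit
    where
    open ≤-Reasoning
    short : length (concatMap members (map proj₁ Zs)) ≤ K * m
    short = begin
      length (concatMap members (map proj₁ Zs))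
        ≡⟨ length-concatMap-members (All-map⁺ {xs = Zs} (All.tabulate λ {Z} _ → size (proj₂ Z))) ⟩
      length (map proj₁ Zs) * m  ≡⟨ cong (_* m) (length-map proj₁ Zs) ⟩
      length Zs * m              ≤⟨ *-monoˡ-≤ m |Zs|≤K ⟩
      K * m                      ∎
    hit : ∀ Y → CliqueIn m N Y → ∃ λ x → x ∈ₛ Y × x ∈ concatMap members (map proj₁ Zs)
    hit Y Y-clique with find (covers Y Y-clique)
    ... | Z , Z∈Zs , x , x∈Y∩Z = x , proj₁ (x∈p∩q⁻ Y _ x∈Y∩Z) , ∈-concatMap⁺ members
            (Any.map (λ { refl → ∈-members⁺ (proj₂ (x∈p∩q⁻ Y _ x∈Y∩Z)) }) (∈-map⁺ proj₁ Z∈Zs))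

  packingOrTransversal : ∀ m σ v K →
                         Packing (cliqueIn? m (oriented? σ v)) K ⊎ Transversal m (K * m) (Oriented σ v)
  packingOrTransversal m σ v K =
    map₂ (coverToTransversal m (oriented? σ v)) (packingOrCover (cliqueIn? m (oriented? σ v)) K)

  module _ {m : ℕ} where

    vertexAt : ∀ {N} → ∃ (CliqueIn m N) → Fin m → Fin n
    vertexAt (Y , Y-clique) = element Y (size Y-clique)

    vertexAt-∈ : ∀ {N} (Y : ∃ (CliqueIn m N)) p → vertexAt Y p ∈ₛ proj₁ Y
    vertexAt-∈ (Y , Y-clique) = element-∈ Y (size Y-clique)

    representatives : ∀ {N} (Ys : List (∃ (CliqueIn m N))) → AllPairs (Disjoint on proj₁) Ys → (p : Fin m) →
                      ∃ λ S → ∣ S ∣ ≡ length Ys × Within N S ×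
                        ∀ y → y ∈ₛ S → ∃ λ Y → Y ∈ Ys × y ≡ vertexAt Y p
    representatives {N} Ys disjoint p = ⋃ (map ⁅_⁆ reps) , |S| , S-within , chosen
      where
      reps : List (Fin n)
      reps = map (λ Y → vertexAt Y p) Ys
      distinct : Unique reps
      distinct = AllPairs-map⁺ (AllPairs.map (λ {Y} {Z} YZ-disjoint same → YZ-disjoint
        (_ , x∈p∩q⁺ (vertexAt-∈ Y p , subst (_∈ₛ proj₁ Z) (sym same) (vertexAt-∈ Z p)))) disjoint)
      |S| : ∣ ⋃ (map ⁅_⁆ reps) ∣ ≡ length Ys
      |S| = trans (∣⋃⁅⁆∣≡length distinct) (length-map _ Ys)
      chosen : ∀ y → y ∈ₛ ⋃ (map ⁅_⁆ reps) → ∃ λ Y → Y ∈ Ys × y ≡ vertexAt Y p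
      chosen y y∈ = ∈-map⁻ (λ Y → vertexAt Y p) (∈-⋃⁅⁆⁻ reps y∈)
      S-within : Within N (⋃ (map ⁅_⁆ reps))
      S-within y y∈ with chosen y y∈
      ... | Y , _ , refl = within (proj₂ Y) _ (vertexAt-∈ Y p)

    firstCliques : ∀ {N k} (Ys : List (∃ (CliqueIn m N))) → k ≤ length Ys → Fin k → ∃ (CliqueIn m N)
    firstCliques Ys k≤ i = lookup Ys (inject≤ i k≤)

    disjointCliques : ∀ {N k} (Ys : List (∃ (CliqueIn m N))) → AllPairs (Disjoint on proj₁) Ys →
                      (k≤ : k ≤ length Ys) → DisjointCliques G k m (proj₁ ∘ firstCliques Ys k≤)
    disjointCliques Ys disjoint k≤ =
      (λ i → clique (proj₂ (firstCliques Ys k≤ i)) , size (proj₂ (firstCliques Ys k≤ i))) ,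
      λ i j i≢j x x∈i x∈j → AllPairs-lookup Disjoint-sym disjoint (i≢j ∘ inject≤-injective k≤ k≤ i j)
                               (x , x∈p∩q⁺ (x∈i , x∈j))

    Complete : Subset n → Subset n → Set
    Complete A B = ∀ a b → a ∈ₛ A → b ∈ₛ B → Adj G a b

    completePairs⇒rich : ∀ {k v} (As : List (∃ (CliqueIn m (Oriented zero v))))
                         (Bs : List (∃ (CliqueIn m (Oriented (suc zero) v)))) →
                         AllPairs (Disjoint on proj₁) As → AllPairs (Disjoint on proj₁) Bs →
                         (k≤As : k ≤ length As) (k≤Bs : k ≤ length Bs) →
                         All (λ A → All (λ B → Complete (proj₁ A) (proj₁ B)) Bs) As → Rich G k m v
    completePairs⇒rich {k} {v} As Bs disjointAs disjointBs k≤As k≤Bs complete =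
      proj₁ ∘ outs , proj₁ ∘ ins , disjointCliques As disjointAs k≤As , disjointCliques Bs disjointBs k≤Bs ,
      within ∘ proj₂ ∘ outs , within ∘ proj₂ ∘ ins ,
      λ i j a b a∈ b∈ → (λ { refl → Adj-irrefl a (adjacent i j a a a∈ b∈) }) , adjacent i j a b a∈ b∈
      where
      outs : Fin k → ∃ (CliqueIn m (Oriented zero v))
      outs = firstCliques As k≤As
      ins : Fin k → ∃ (CliqueIn m (Oriented (suc zero) v))
      ins = firstCliques Bs k≤Bs
      adjacent : ∀ i j → Complete (proj₁ (outs i)) (proj₁ (ins j))
      adjacent i j = All.lookup (All.lookup complete (∈-lookup _)) (∈-lookup _)

    missingEdges⇒¬spread : ∀ {λ′ v} → Spread G λ′ → (As : List (∃ (CliqueIn m (Oriented zero v))))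
                           (Bs : List (∃ (CliqueIn m (Oriented (suc zero) v)))) →
                           AllPairs (Disjoint on proj₁) As → AllPairs (Disjoint on proj₁) Bs →
                           λ′ ≤ length As → λ′ ≤ length Bs → ∀ p q →
                           All (λ A → All (λ B → ¬ Adj G (vertexAt A p) (vertexAt B q)) Bs) As → ⊥
    missingEdges⇒¬spread {λ′} {v} spread As Bs disjointAs disjointBs λ≤As λ≤Bs p q missing
      with sublistOfLength λ′ As λ≤As | sublistOfLength λ′ Bs λ≤Bs
    ... | As′ , As′⊆ , |As′| | Bs′ , Bs′⊆ , |Bs′|
      with representatives As′ (AllPairs-resp-⊆ As′⊆ disjointAs) p
         | representatives Bs′ (AllPairs-resp-⊆ Bs′⊆ disjointBs) q
    ... | S , |S| , S-out , S-reps | T , |T| , T-in , T-reps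
      with spread v S T S-out T-in (trans |S| |As′|) (trans |T| |Bs′|)
    ... | a , b , a∈S , b∈T , a~b with S-reps a a∈S | T-reps b b∈T
    ... | A , A∈ , refl | B , B∈ , refl =
      All.lookup (All-resp-⊆ Bs′⊆ (All.lookup (All-resp-⊆ As′⊆ missing) A∈)) B∈ a~b

    module _ {N₁ N₂ : Fin n → Set} where

      classifyPair : ∀ (A : ∃ (CliqueIn m N₁)) (B : ∃ (CliqueIn m N₂)) →
                     (∀ p q → Adj G (vertexAt A p) (vertexAt B q)) ⊎
                     ∃₂ λ p q → ¬ Adj G (vertexAt A p) (vertexAt B q)
      classifyPair A B with all? (λ p → all? (λ q → adj? (vertexAt A p) (vertexAt B q)))
      ... | yes complete = inj₁ complete
      ... | no incomplete
        with ¬∀⟶∃¬ m _ (λ p → all? λ q → adj? (vertexAt A p) (vertexAt B q)) incomplete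
      ... | p , ¬p with ¬∀⟶∃¬ m _ (λ q → adj? (vertexAt A p) (vertexAt B q)) ¬p
      ... | q , ¬pq = inj₂ (p , q , ¬pq)

      pairColour : ∃ (CliqueIn m N₁) → ∃ (CliqueIn m N₂) → Fin (suc (m * m))
      pairColour A B = [ (λ _ → zero) , (λ (p , q , _) → suc (combine p q)) ]′ (classifyPair A B)

      pairColour≡zero⇒complete : ∀ A B → pairColour A B ≡ zero → Complete (proj₁ A) (proj₁ B)
      pairColour≡zero⇒complete A B colour≡ a b a∈ b∈
        with classifyPair A B | element-surjective _ (size (proj₂ A)) a∈
                              | element-surjective _ (size (proj₂ B)) b∈
      ... | inj₁ complete | p , refl | q , refl = complete p q

      pairColour≡suc⇒missing : ∀ A B {w} → pairColour A B ≡ suc w →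
                               ¬ Adj G (vertexAt A (proj₁ (remQuot {m} m w)))
                                       (vertexAt B (proj₂ (remQuot {m} m w)))
      pairColour≡suc⇒missing A B colour≡ with classifyPair A B
      pairColour≡suc⇒missing A B refl | inj₂ (p , q , ¬pq) =
        subst (λ (p′ , q′) → ¬ Adj G (vertexAt A p′) (vertexAt B q′))
              (sym (remQuot-combine {m} {m} p q)) ¬pq

-- Enough out- and in-cliques for bipartiteRamsey, with suc (m * m) colours, to return k + λ′ of each.
packingSize : ℕ → ℕ → ℕ → ℕ
packingSize λ′ k m = suc (rows + suc (m * m) ^ suc rows * (k + λ′))
  where
  rows : ℕ
  rows = suc (m * m) * (k + λ′)

module _ (G : Digraph n) {m : ℕ} where

  packings⇒rich : ∀ {λ′ k v} → Spread G λ′ →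
                  Packing (cliqueIn? G m (oriented? G zero v)) (packingSize λ′ k m) →
                  Packing (cliqueIn? G m (oriented? G (suc zero) v)) (packingSize λ′ k m) → Rich G k m v
  packings⇒rich {λ′} {k} spread (As , |As| , disjointAs) (Bs , |Bs| , disjointBs)
    with bipartiteRamsey (pairColour G) (k + λ′) As Bs
           (subst (_ <_) (sym |As|) (s≤s (m≤m+n _ _))) (subst (_ <_) (sym |Bs|) (s≤s (m≤n+m _ _)))
  ... | As′ , Bs′ , As′⊆ , Bs′⊆ , r<As′ , r<Bs′ , zero , mono =
    completePairs⇒rich G As′ Bs′ (AllPairs-resp-⊆ As′⊆ disjointAs) (AllPairs-resp-⊆ Bs′⊆ disjointBs)
      (≤-trans (m≤m+n k λ′) (<⇒≤ r<As′)) (≤-trans (m≤m+n k λ′) (<⇒≤ r<Bs′))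
      (All.map (λ {A} → All.map (λ {B} → pairColour≡zero⇒complete G A B)) mono)
  ... | As′ , Bs′ , As′⊆ , Bs′⊆ , r<As′ , r<Bs′ , suc w , mono = ⊥-elim
    (missingEdges⇒¬spread G spread As′ Bs′
      (AllPairs-resp-⊆ As′⊆ disjointAs) (AllPairs-resp-⊆ Bs′⊆ disjointBs)
      (≤-trans (m≤n+m λ′ k) (<⇒≤ r<As′)) (≤-trans (m≤n+m λ′ k) (<⇒≤ r<Bs′)) _ _
      (All.map (λ {A} → All.map (λ {B} → pairColour≡suc⇒missing G A B)) mono))

  oneSidedTransversal : ∀ {λ′ k} → Spread G λ′ → ∀ v → ¬ Rich G k m v →
                        ∃ λ σ → Transversal G m (packingSize λ′ k m * m) (Oriented G σ v)
  oneSidedTransversal {λ′} {k} spread v notRich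
    with packingOrTransversal G m zero v (packingSize λ′ k m)
       | packingOrTransversal G m (suc zero) v (packingSize λ′ k m)
  ... | inj₂ outTransversal | _                  = zero , outTransversal
  ... | inj₁ _             | inj₂ inTransversal  = suc zero , inTransversal
  ... | inj₁ outPacking    | inj₁ inPacking      =
    ⊥-elim (notRich (packings⇒rich spread outPacking inPacking))

mainTheorem4 : (λ' k m : ℕ) → k ≥ 1 → m ≥ 1 →
    Σ ℕ λ t → ∀ (n : ℕ) (G : Digraph n) → Spread G λ' →
    (∀ v → ¬ Rich G k m v) →
    Σ (Fin n → Fin t) λ f →
    ∀ i → NoSourcedClique G f i m ⊎ NoSinkedClique G f i m
mainTheorem4 λ' k m _ _ = 2 * 4 ^ (packingSize λ' k m * m) , λ n G spread notRich →
  oneSidedPartition G m _ λ v → oneSidedTransversal G spread v (notRich v)
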